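{- Let $F$ be a field of characteristic $0$ and let $p(x_1,\dots,x_d)=\sum_{\sigma\in S_d}\alpha_\sigma x_{\sigma(1)}\cdots x_{\sigma(d)}$ with $\alpha_\sigma\in F$. Then $p$ is a polynomial identity of $E\otimes E$ if and only if for every pair of subsets $I_1,I_2\subseteq\{1,\dots,d\}$, \[ \sum_{\sigma\in S_d}\alpha_\sigma f_{I_1}(\sigma)f_{I_2}(\sigma)=0 . \]
   Context: $E$ is the infinite-dimensional Grassmann algebra over $F$, generated by $e_1,e_2,\dots$ with $e_ie_j=-e_je_i$, with its $\mathbb{Z}_2$-grading $E=E_0\oplus E_1$ (spanned by products of an even, resp. odd, number of generators); $E\otimes E$ is its tensor square over $F$. For $I\subseteq\{1,\dots,d\}$ and $\sigma\in S_d$, $f_I(\sigma)\in\{\pm1\}$ is defined by: choose $a_1,\dots,a_d\in E_0\cup E_1$ with $a_i\in E_1$ iff $i\in I$ and $a_1\cdots a_d\neq0$; then $a_{\sigma(1)}\cdots a_{\sigma(d)}=f_I(\sigma)\,a_1\cdots a_d$. -}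

module Defs where

open import Level using (_⊔_) renaming (suc to lsuc)
open import Algebra.Bundles using (CommutativeRing)
open import Data.Bool using (Bool; true; false; not; _∧_; if_then_else_)
open import Data.Nat using (ℕ; zero; suc; _<ᵇ_; _≡ᵇ_)
import Data.Nat as ℕ
open import Data.Fin using (Fin; toℕ)
open import Data.Fin.Subset using (Subset; Side; inside; outside)
open import Data.Vec using (Vec; []; _∷_; lookup; toList)
open import Data.List using (List; []; _∷_; [_]; map; concatMap; allFin; filterᵇ; foldr; _++_)
open import Data.Bool.ListAction using (any)
open import Data.Maybe using (Maybe; just; nothing)
open import Data.Product using (_×_; _,_; ∃)
open import Relation.Nullary using (¬_)

record Field c ℓ : Set (lsuc (c ⊔ ℓ)) where
  field
    commutativeRing : CommutativeRing c ℓ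
  open CommutativeRing commutativeRing public
  field
    1≉0 : ¬ (1# ≈ 0#)
    inverse : ∀ x → ¬ (x ≈ 0#) → ∃ λ y → (x * y) ≈ 1#

module _ {c ℓ} (F : Field c ℓ) where
  open Field F

  natCast : ℕ → Carrier
  natCast zero    = 0#
  natCast (suc n) = 1# + natCast n

  CharZero : Set ℓ
  CharZero = ∀ n → ¬ (natCast (suc n) ≈ 0#)

-- Grassmann algebra E with generators e_0, e_1, ... (indexed by ℕ).
-- A word  w = [i₁,…,iₖ]  denotes the product e_{i₁}⋯e_{iₖ}.
-- Normal form: strictly increasing list of indices with a sign
-- (true = negative), or nothing if the product is 0.

insertS : ℕ → List ℕ → Maybe (Bool × List ℕ)
insertS x [] = just (false , x ∷ [])
insertS x (y ∷ ys) with x <ᵇ y | x ≡ᵇ y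
... | true  | _     = just (false , x ∷ y ∷ ys)
... | false | true  = nothing
... | false | false with insertS x ys
...   | nothing        = nothing
...   | just (s , zs)  = just (not s , y ∷ zs)

normW : List ℕ → Maybe (Bool × List ℕ)
normW [] = just (false , [])
normW (x ∷ w) with normW w
... | nothing = nothing
... | just (s , v) with insertS x v
...   | nothing = nothing
...   | just (t , u) = just (xorB s t , u)
  where
  xorB : Bool → Bool → Bool
  xorB false b = b
  xorB true  b = not b

eqL : List ℕ → List ℕ → Bool
eqL [] [] = true
eqL [] (_ ∷ _) = false
eqL (_ ∷ _) [] = false
eqL (x ∷ xs) (y ∷ ys) = (x ≡ᵇ y) ∧ eqL xs ys

module _ {c ℓ} (F : Field c ℓ) where
  open Field F

  sgn : Bool → Carrier
  sgn false = 1#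
  sgn true  = - 1#

  -- coefficient of the basis monomial e_s (s strictly increasing) in word w
  coeffW : List ℕ → List ℕ → Carrier
  coeffW w s with normW w
  ... | nothing = 0#
  ... | just (b , v) = if eqL v s then sgn b else 0#

  -- E ⊗ E : an element is a finite linear combination of pure tensors
  -- (word ⊗ word); (a ⊗ b)(c ⊗ d) = ac ⊗ bd.

  EE : Set c
  EE = List (Carrier × List ℕ × List ℕ)

  zeroEE : EE
  zeroEE = []

  oneEE : EE
  oneEE = [ (1# , [] , []) ]

  _+EE_ : EE → EE → EE
  x +EE y = x ++ y

  _·EE_ : Carrier → EE → EE
  k ·EE x = map (λ { (a , u , v) → (k * a , u , v) }) x

  _*EE_ : EE → EE → EE
  x *EE y = concatMap (λ { (a , u , v) →
              map (λ { (b , u' , v') → (a * b , u ++ u' , v ++ v') }) y }) x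

  coeffEE : EE → List ℕ → List ℕ → Carrier
  coeffEE x s₁ s₂ =
    foldr _+_ 0# (map (λ { (a , u , v) → a * (coeffW u s₁ * coeffW v s₂) }) x)

  -- x = 0 in E ⊗ E : every coordinate w.r.t. the basis vanishes
  IsZeroEE : EE → Set ℓ
  IsZeroEE x = ∀ s₁ s₂ → coeffEE x s₁ s₂ ≈ 0#

-- The symmetric group S_d: permutations of Fin d, represented as the
-- vector (σ(0),…,σ(d-1)) with pairwise distinct entries.

allVecs : (n k : ℕ) → List (Vec (Fin k) n)
allVecs zero    k = [ [] ]
allVecs (suc n) k = concatMap (λ i → map (i ∷_) (allVecs n k)) (allFin k)

distinctᵇ : ∀ {k} → List (Fin k) → Bool
distinctᵇ [] = true
distinctᵇ (x ∷ xs) = not (any (λ y → toℕ x ≡ᵇ toℕ y) xs) ∧ distinctᵇ xs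

perms : (d : ℕ) → List (Vec (Fin d) d)
perms d = filterᵇ (λ σ → distinctᵇ (toList σ)) (allVecs d d)

module _ {c ℓ} (F : Field c ℓ) where
  open Field F

  sumPerms : (d : ℕ) → (Vec (Fin d) d → Carrier) → Carrier
  sumPerms d g = foldr _+_ 0# (map g (perms d))

  prodEE : ∀ {d} → (Fin d → EE F) → Vec (Fin d) d → EE F
  prodEE a σ = foldr (λ i r → _*EE_ F (a i) r) (oneEE F) (toList σ)

  evalP : (d : ℕ) → (Vec (Fin d) d → Carrier) → (Fin d → EE F) → EE F
  evalP d α a = foldr (_+EE_ F) (zeroEE F)
                  (map (λ σ → _·EE_ F (α σ) (prodEE a σ)) (perms d))

  IsPIofEE : (d : ℕ) → (Vec (Fin d) d → Carrier) → Set (c ⊔ ℓ)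
  IsPIofEE d α = ∀ (a : Fin d → EE F) → IsZeroEE F (evalP d α a)

-- f_I(σ): following the definition, choose homogeneous a_1,…,a_d with
-- a_i odd iff i ∈ I and a_1⋯a_d ≠ 0; concretely (0-indexed)
--   a_i = e_{3i}            if i ∈ I   (odd)
--   a_i = e_{3i+1} e_{3i+2} if i ∉ I   (even).
-- Then a_1⋯a_d is a basis monomial in normal form with sign +, so
-- f_I(σ) is the sign of the normal form of a_{σ(1)}⋯a_{σ(d)}.

genWord : ∀ {d} → Subset d → Fin d → List ℕ
genWord I i with lookup I i
... | inside  = 3 ℕ.* toℕ i ∷ []
... | outside = suc (3 ℕ.* toℕ i) ∷ suc (suc (3 ℕ.* toℕ i)) ∷ []

module _ {c ℓ} (F : Field c ℓ) where
  open Field F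

  fI : ∀ {d} → Subset d → Vec (Fin d) d → Carrier
  fI I σ with normW (concatMap (genWord I) (toList σ))
  ... | nothing = 0#   -- never happens (product is nonzero)
  ... | just (b , _) = sgn F b

-- The coefficients of p(a₁,…,a_d) ∈ E ⊗ E in the basis e_u ⊗ e_v are multilinear in the aᵢ, so p is an
-- identity iff it vanishes whenever every aᵢ is a pure tensor e_{uᵢ} ⊗ e_{vᵢ} of Grassmann monomials.
-- Reordering a product of homogeneous elements of E changes it by a sign that depends only on their
-- parities, so for such arguments a_{σ(1)}⋯a_{σ(d)} = f_{I₁}(σ) f_{I₂}(σ) · e_{u₁⋯u_d} ⊗ e_{v₁⋯v_d}, where
-- I₁ and I₂ record which uᵢ and vᵢ have odd length. Hence
--   p(a) = (Σ_σ α_σ f_{I₁}(σ) f_{I₂}(σ)) · e_{u₁⋯u_d} ⊗ e_{v₁⋯v_d},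
-- which gives one direction; the other follows by choosing the uᵢ, vᵢ used to define f_{I₁} and f_{I₂},
-- for which e_{u₁⋯u_d} and e_{v₁⋯v_d} are basis elements with coefficient 1.

module Submission where

open import Defs
import Algebra.Properties.CommutativeSemigroup as CommutativeSemigroupProperties
import Algebra.Properties.Ring as RingProperties
open import Data.Bool using (Bool; true; false; not; _∧_; _xor_; T; if_then_else_)
open import Data.Bool.Properties using (xor-assoc; xor-comm; xor-identityʳ; xor-same; T-≡; T-∧)
open import Data.Nat using (ℕ; zero; suc; _<ᵇ_; _≡ᵇ_; _<_; _≤_; s≤s; s<s)
import Data.Nat as ℕ
open import Data.Nat.Properties
  using (<-cmp; <-trans; ≤-refl; ≤-trans; ≤-reflexive; <⇒≤; <⇒<ᵇ; ≡⇒≡ᵇ; n≤1+n; m≤n+m; *-suc; +-suc)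
import Data.Nat.Properties as ℕₚ
open import Data.Fin using (Fin; toℕ)
import Data.Fin as Fin
open import Data.Fin.Properties using (_≟_)
open import Data.Fin.Subset using (Subset)
open import Data.List using (List; []; _∷_; _++_; map; foldr; concatMap; allFin; tabulate; length)
open import Data.List.Properties using (length-tabulate; map-cong)
open import Data.List.Membership.Propositional using (_∈_; _∉_)
open import Data.List.Membership.Propositional.Properties
  using (∈-∃++; ∈-++⁻; ∈-++⁺ˡ; ∈-++⁺ʳ; ∈-allFin; ∈-filter⁻)
open import Data.List.Relation.Binary.Permutation.Propositional as ↭ using (_↭_; prep; swap; ↭-sym; ↭-trans)
open import Data.List.Relation.Binary.Permutation.Propositional.Properties using (shift; ↭-length; ∈-resp-↭)
open import Data.List.Relation.Binary.Subset.Propositional using (_⊆_)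
open import Data.List.Relation.Unary.All as All using (All)
open import Data.List.Relation.Unary.All.Properties using (¬Any⇒All¬)
import Data.List.Relation.Unary.Any as Any
open import Data.List.Relation.Unary.Any using (here; there)
open import Data.List.Relation.Unary.Any.Properties using (any⁺)
open import Data.List.Relation.Unary.AllPairs using ([]; _∷_)
open import Data.List.Relation.Unary.Unique.Propositional using (Unique)
open import Data.Maybe using (Maybe; just; nothing)
open import Data.Product using (_×_; _,_; proj₁; proj₂; ∃₂)
open import Data.Sum using (inj₁; inj₂)
open import Data.Vec using (Vec; lookup; toList)
import Data.Vec as Vec
open import Data.Vec.Properties using (length-toList; lookup∘tabulate)
open import Data.Vec.Functional using (updateAt)
open import Data.Vec.Functional.Properties using (updateAt-updates; updateAt-minimal; updateAt-id-local)
open import Function.Base using (_∘_; const)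
open import Function.Bundles using (Equivalence)
open import Relation.Binary.Definitions using (tri<; tri≈; tri>)
open import Relation.Binary.PropositionalEquality as ≡ using (_≡_; _≢_; _≗_; ≢-sym)
open import Relation.Nullary using (¬_; yes; no; contradiction)
open import Relation.Nullary.Decidable using (T?)

-- Signs of reorderings in the Grassmann algebra

NF : Set
NF = Maybe (Bool × List ℕ)

flipNF : Bool → NF → NF
flipNF b nothing        = nothing
flipNF b (just (s , v)) = just (b xor s , v)

consNF : ℕ → NF → NF
consNF z nothing        = nothing
consNF z (just (s , v)) = just (s , z ∷ v)

insertNF : ℕ → NF → NF
insertNF x nothing        = nothing
insertNF x (just (s , v)) = flipNF s (insertS x v)

flipNF-false : ∀ m → flipNF false m ≡ m
flipNF-false nothing  = ≡.refl
flipNF-false (just _) = ≡.refl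

flipNF-xor : ∀ a b m → flipNF a (flipNF b m) ≡ flipNF (a xor b) m
flipNF-xor a b nothing        = ≡.refl
flipNF-xor a b (just (s , v)) = ≡.cong (λ t → just (t , v)) (≡.sym (xor-assoc a b s))

flipNF-comm : ∀ a b m → flipNF a (flipNF b m) ≡ flipNF b (flipNF a m)
flipNF-comm a b m = begin
  flipNF a (flipNF b m)  ≡⟨ flipNF-xor a b m ⟩
  flipNF (a xor b) m     ≡⟨ ≡.cong (λ t → flipNF t m) (xor-comm a b) ⟩
  flipNF (b xor a) m     ≡⟨ ≡.sym (flipNF-xor b a m) ⟩
  flipNF b (flipNF a m)  ∎
  where open ≡.≡-Reasoning

flipNF-true-involutive : ∀ m → flipNF true (flipNF true m) ≡ m
flipNF-true-involutive m = ≡.trans (flipNF-xor true true m) (flipNF-false m)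

flipNF-consNF : ∀ b z m → flipNF b (consNF z m) ≡ consNF z (flipNF b m)
flipNF-consNF b z nothing  = ≡.refl
flipNF-consNF b z (just _) = ≡.refl

insertNF-flipNF : ∀ x b m → insertNF x (flipNF b m) ≡ flipNF b (insertNF x m)
insertNF-flipNF x b nothing        = ≡.refl
insertNF-flipNF x b (just (s , v)) = ≡.sym (flipNF-xor b s (insertS x v))

normW-∷ : ∀ x w → normW (x ∷ w) ≡ insertNF x (normW w)
normW-∷ x w with normW w
... | nothing = ≡.refl
... | just (false , v) with insertS x v
...   | nothing      = ≡.refl
...   | just (t , u) = ≡.refl
normW-∷ x w | just (true , v) with insertS x v
...   | nothing      = ≡.refl
...   | just (t , u) = ≡.refl

T⇒≡true : ∀ {b} → T b → b ≡ true
T⇒≡true = Equivalence.to T-≡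

<ᵇ-false : ∀ {x y} → y ≤ x → (x <ᵇ y) ≡ false
<ᵇ-false {x}     {zero}  _       = ≡.refl
<ᵇ-false {suc x} {suc y} (s≤s p) = <ᵇ-false p

≡ᵇ-false : ∀ {x y} → y < x → (x ≡ᵇ y) ≡ false
≡ᵇ-false {suc x} {zero}  _       = ≡.refl
≡ᵇ-false {suc x} {suc y} (s<s p) = ≡ᵇ-false p

eqL-refl : ∀ v → eqL v v ≡ true
eqL-refl []      = ≡.refl
eqL-refl (x ∷ v) rewrite T⇒≡true (≡⇒≡ᵇ x x ≡.refl) = eqL-refl v

insertS-< : ∀ {x z} zs → x < z → insertS x (z ∷ zs) ≡ just (false , x ∷ z ∷ zs)
insertS-< zs x<z rewrite T⇒≡true (<⇒<ᵇ x<z) = ≡.refl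

insertS-≡ : ∀ x zs → insertS x (x ∷ zs) ≡ nothing
insertS-≡ x zs rewrite <ᵇ-false (≤-refl {x}) | T⇒≡true (≡⇒≡ᵇ x x ≡.refl) = ≡.refl

insertS-> : ∀ {x z} zs → z < x → insertS x (z ∷ zs) ≡ flipNF true (consNF z (insertS x zs))
insertS-> {x} zs z<x rewrite <ᵇ-false (<⇒≤ z<x) | ≡ᵇ-false z<x with insertS x zs
... | nothing = ≡.refl
... | just _  = ≡.refl

insertNF-consNF-> : ∀ {x z} m → z < x → insertNF x (consNF z m) ≡ flipNF true (consNF z (insertNF x m))
insertNF-consNF-> nothing        z<x = ≡.refl
insertNF-consNF-> {x} {z} (just (s , u)) z<x = begin
  flipNF s (insertS x (z ∷ u))                     ≡⟨ ≡.cong (flipNF s) (insertS-> u z<x) ⟩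
  flipNF s (flipNF true (consNF z (insertS x u)))  ≡⟨ flipNF-comm s true _ ⟩
  flipNF true (flipNF s (consNF z (insertS x u)))  ≡⟨ ≡.cong (flipNF true) (flipNF-consNF s z _) ⟩
  flipNF true (consNF z (flipNF s (insertS x u)))  ∎
  where open ≡.≡-Reasoning

insertNF-consNF-self : ∀ x m → insertNF x (consNF x m) ≡ nothing
insertNF-consNF-self x nothing        = ≡.refl
insertNF-consNF-self x (just (s , u)) rewrite insertS-≡ x u = ≡.refl

insertNF-insertS-below : ∀ {x y z} zs → z < x → z < y →
  insertNF x (insertS y (z ∷ zs)) ≡ consNF z (insertNF x (insertS y zs))
insertNF-insertS-below {x} {y} {z} zs z<x z<y = begin
  insertNF x (insertS y (z ∷ zs))                            ≡⟨ ≡.cong (insertNF x) (insertS-> zs z<y) ⟩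
  insertNF x (flipNF true (consNF z (insertS y zs)))         ≡⟨ insertNF-flipNF x true (consNF z (insertS y zs)) ⟩
  flipNF true (insertNF x (consNF z (insertS y zs)))         ≡⟨ ≡.cong (flipNF true) (insertNF-consNF-> (insertS y zs) z<x) ⟩
  flipNF true (flipNF true (consNF z (insertNF x (insertS y zs)))) ≡⟨ flipNF-true-involutive _ ⟩
  consNF z (insertNF x (insertS y zs))                       ∎
  where open ≡.≡-Reasoning

insertNF-insertS-self : ∀ x v → insertNF x (insertS x v) ≡ nothing
insertNF-insertS-self x [] rewrite insertS-≡ x [] = ≡.refl
insertNF-insertS-self x (z ∷ zs) with <-cmp x z
... | tri< x<z _ _ rewrite insertS-< zs x<z | insertS-≡ x (z ∷ zs) = ≡.refl
... | tri≈ _ ≡.refl _ rewrite insertS-≡ x zs = ≡.refl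
... | tri> _ _ z<x rewrite insertNF-insertS-below zs z<x z<x | insertNF-insertS-self x zs = ≡.refl

-- Stated for every word v, sorted or not, so that the induction needs no invariant.
insertNF-insertS-anticomm-< : ∀ {x y} v → x < y →
  insertNF x (insertS y v) ≡ flipNF true (insertNF y (insertS x v))
insertNF-insertS-anticomm-< [] x<y rewrite insertS-< [] x<y | insertS-> [] x<y = ≡.refl
insertNF-insertS-anticomm-< {x} {y} (z ∷ zs) x<y with <-cmp x z
... | tri≈ _ ≡.refl _ rewrite insertS-> zs x<y | insertS-≡ x zs
                          | insertNF-flipNF x true (consNF x (insertS y zs))
                          | insertNF-consNF-self x (insertS y zs) = ≡.refl
... | tri> _ _ z<x = begin
  insertNF x (insertS y (z ∷ zs))                       ≡⟨ insertNF-insertS-below zs z<x (<-trans z<x x<y) ⟩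
  consNF z (insertNF x (insertS y zs))                  ≡⟨ ≡.cong (consNF z) (insertNF-insertS-anticomm-< zs x<y) ⟩
  consNF z (flipNF true (insertNF y (insertS x zs)))    ≡⟨ ≡.sym (flipNF-consNF true z _) ⟩
  flipNF true (consNF z (insertNF y (insertS x zs)))    ≡⟨ ≡.cong (flipNF true) (≡.sym (insertNF-insertS-below zs (<-trans z<x x<y) z<x)) ⟩
  flipNF true (insertNF y (insertS x (z ∷ zs)))         ∎
  where open ≡.≡-Reasoning
... | tri< x<z _ _ with <-cmp y z
...   | tri< y<z _ _ rewrite insertS-< zs y<z | insertS-< zs x<z
                           | insertS-< (z ∷ zs) x<y | insertS-> (z ∷ zs) x<y | insertS-< zs y<z = ≡.refl
...   | tri≈ _ ≡.refl _ rewrite insertS-≡ y zs | insertS-< zs x<y | insertS-> (y ∷ zs) x<y | insertS-≡ y zs = ≡.refl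
...   | tri> _ _ z<y rewrite insertS-> zs z<y | insertS-< zs x<z | insertS-> (z ∷ zs) x<y | insertS-> zs z<y
  with insertS y zs
...     | nothing = ≡.refl
...     | just (false , u) rewrite insertS-< u x<z = ≡.refl
...     | just (true , u)  rewrite insertS-< u x<z = ≡.refl

insertNF-insertS-anticomm : ∀ x y v → insertNF x (insertS y v) ≡ flipNF true (insertNF y (insertS x v))
insertNF-insertS-anticomm x y v with <-cmp x y
... | tri< x<y _ _ = insertNF-insertS-anticomm-< v x<y
... | tri≈ _ ≡.refl _ rewrite insertNF-insertS-self x v = ≡.refl
... | tri> _ _ y<x = begin
  insertNF x (insertS y v)                               ≡⟨ ≡.sym (flipNF-true-involutive _) ⟩
  flipNF true (flipNF true (insertNF x (insertS y v)))   ≡⟨ ≡.cong (flipNF true) (≡.sym (insertNF-insertS-anticomm-< v y<x)) ⟩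
  flipNF true (insertNF y (insertS x v))                 ∎
  where open ≡.≡-Reasoning

insertNF-anticomm : ∀ x y m → insertNF x (insertNF y m) ≡ flipNF true (insertNF y (insertNF x m))
insertNF-anticomm x y nothing        = ≡.refl
insertNF-anticomm x y (just (s , v)) = begin
  insertNF x (flipNF s (insertS y v))                ≡⟨ insertNF-flipNF x s (insertS y v) ⟩
  flipNF s (insertNF x (insertS y v))                ≡⟨ ≡.cong (flipNF s) (insertNF-insertS-anticomm x y v) ⟩
  flipNF s (flipNF true (insertNF y (insertS x v)))  ≡⟨ flipNF-comm s true _ ⟩
  flipNF true (flipNF s (insertNF y (insertS x v)))  ≡⟨ ≡.cong (flipNF true) (≡.sym (insertNF-flipNF y s (insertS x v))) ⟩
  flipNF true (insertNF y (flipNF s (insertS x v)))  ∎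
  where open ≡.≡-Reasoning

oddLength : List ℕ → Bool
oddLength []      = false
oddLength (_ ∷ w) = not (oddLength w)

-- w ≃[ s ] w′: the products of the generators along w and w′ agree in E up to the sign (-1)^s.
infix 4 _≃[_]_

record _≃[_]_ (w : List ℕ) (s : Bool) (w′ : List ℕ) : Set where
  constructor mk≃
  field normW-≃ : normW w ≡ flipNF s (normW w′)

open _≃[_]_ public

≃-refl : ∀ {w} → w ≃[ false ] w
≃-refl = mk≃ (≡.sym (flipNF-false _))

≃-trans : ∀ {u v w s t} → u ≃[ s ] v → v ≃[ t ] w → u ≃[ s xor t ] w
≃-trans {s = s} {t} (mk≃ u≃v) (mk≃ v≃w) = mk≃ (≡.trans u≃v (≡.trans (≡.cong (flipNF s) v≃w) (flipNF-xor s t _)))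

≃-∷ : ∀ {w w′ s} x → w ≃[ s ] w′ → x ∷ w ≃[ s ] x ∷ w′
≃-∷ {w} {w′} {s} x (mk≃ w≃w′) = mk≃ (begin
  normW (x ∷ w)                    ≡⟨ normW-∷ x w ⟩
  insertNF x (normW w)             ≡⟨ ≡.cong (insertNF x) w≃w′ ⟩
  insertNF x (flipNF s (normW w′)) ≡⟨ insertNF-flipNF x s (normW w′) ⟩
  flipNF s (insertNF x (normW w′)) ≡⟨ ≡.cong (flipNF s) (≡.sym (normW-∷ x w′)) ⟩
  flipNF s (normW (x ∷ w′))        ∎)
  where open ≡.≡-Reasoning

≃-++ˡ : ∀ {w w′ s} a → w ≃[ s ] w′ → a ++ w ≃[ s ] a ++ w′
≃-++ˡ []      w≃w′ = w≃w′
≃-++ˡ (x ∷ a) w≃w′ = ≃-∷ x (≃-++ˡ a w≃w′)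

≃-swap : ∀ x y c → x ∷ y ∷ c ≃[ true ] y ∷ x ∷ c
≃-swap x y c = mk≃ (begin
  normW (x ∷ y ∷ c)                               ≡⟨ normW-∷ x (y ∷ c) ⟩
  insertNF x (normW (y ∷ c))                      ≡⟨ ≡.cong (insertNF x) (normW-∷ y c) ⟩
  insertNF x (insertNF y (normW c))               ≡⟨ insertNF-anticomm x y (normW c) ⟩
  flipNF true (insertNF y (insertNF x (normW c))) ≡⟨ ≡.cong (flipNF true ∘ insertNF y) (≡.sym (normW-∷ x c)) ⟩
  flipNF true (insertNF y (normW (x ∷ c)))        ≡⟨ ≡.cong (flipNF true) (≡.sym (normW-∷ y (x ∷ c))) ⟩
  flipNF true (normW (y ∷ x ∷ c))                 ∎)
  where open ≡.≡-Reasoning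

≃-move : ∀ x b c → x ∷ b ++ c ≃[ oddLength b ] b ++ x ∷ c
≃-move x []      c = ≃-refl
≃-move x (y ∷ b) c = ≃-trans (≃-swap x y (b ++ c)) (≃-∷ y (≃-move x b c))

≃-block : ∀ a b c → a ++ b ++ c ≃[ oddLength a ∧ oddLength b ] b ++ a ++ c
≃-block []      b c = ≃-refl
≃-block (x ∷ a) b c =
  ≡.subst (x ∷ a ++ b ++ c ≃[_] b ++ x ∷ a ++ c) (sign (oddLength a) (oddLength b))
        (≃-trans (≃-∷ x (≃-block a b c)) (≃-move x b (a ++ c)))
  where
  sign : ∀ p q → (p ∧ q) xor q ≡ not p ∧ q
  sign false q = ≡.refl
  sign true  q = xor-same q

module _ {a} {A : Set a} where

  permSign : (A → Bool) → {xs ys : List A} → xs ↭ ys → Bool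
  permSign p ↭.refl         = false
  permSign p (prep x q)     = permSign p q
  permSign p (swap x y q)   = (p x ∧ p y) xor permSign p q
  permSign p (↭.trans q q′) = permSign p q xor permSign p q′

  permSign-cong : ∀ {p p′} → p ≗ p′ → ∀ {xs ys} (q : xs ↭ ys) → permSign p q ≡ permSign p′ q
  permSign-cong p≗p′ ↭.refl         = ≡.refl
  permSign-cong p≗p′ (prep x q)     = permSign-cong p≗p′ q
  permSign-cong p≗p′ (swap x y q)   = ≡.cong₂ _xor_ (≡.cong₂ _∧_ (p≗p′ x) (p≗p′ y)) (permSign-cong p≗p′ q)
  permSign-cong p≗p′ (↭.trans q q′) = ≡.cong₂ _xor_ (permSign-cong p≗p′ q) (permSign-cong p≗p′ q′)

  concatMap-↭ : ∀ (U : A → List ℕ) {xs ys} (q : xs ↭ ys) →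
                concatMap U xs ≃[ permSign (oddLength ∘ U) q ] concatMap U ys
  concatMap-↭ U ↭.refl         = ≃-refl
  concatMap-↭ U (prep x q)     = ≃-++ˡ (U x) (concatMap-↭ U q)
  concatMap-↭ U (swap x y q)   = ≃-trans (≃-block (U x) (U y) _) (≃-++ˡ (U y) (≃-++ˡ (U x) (concatMap-↭ U q)))
  concatMap-↭ U (↭.trans q q′) = ≃-trans (concatMap-↭ U q) (concatMap-↭ U q′)

  unique∧⊆∧length≤⇒↭ : ∀ {xs ys : List A} → Unique xs → xs ⊆ ys → length ys ≤ length xs → xs ↭ ys
  unique∧⊆∧length≤⇒↭ {[]} {[]}    _ _ _  = ↭.refl
  unique∧⊆∧length≤⇒↭ {[]} {_ ∷ _} _ _ ()
  unique∧⊆∧length≤⇒↭ {x ∷ xs} (x∉xs ∷ unique) xs⊆ys len≤ with ∈-∃++ (xs⊆ys (here ≡.refl))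
  ... | ys₁ , ys₂ , ≡.refl =
    ↭-trans (prep x (unique∧⊆∧length≤⇒↭ unique xs⊆ys₁++ys₂ len≤′)) (↭-sym (shift x ys₁ ys₂))
    where
    xs⊆ys₁++ys₂ : xs ⊆ ys₁ ++ ys₂
    xs⊆ys₁++ys₂ {y} y∈xs with ∈-++⁻ ys₁ (xs⊆ys (there y∈xs))
    ... | inj₁ y∈ys₁                = ∈-++⁺ˡ y∈ys₁
    ... | inj₂ (here y≡x)       = contradiction (≡.sym y≡x) (All.lookup x∉xs y∈xs)
    ... | inj₂ (there y∈ys₂)    = ∈-++⁺ʳ ys₁ y∈ys₂
    len≤′ : length (ys₁ ++ ys₂) ≤ length xs
    len≤′ with ≡.subst (_≤ suc (length xs)) (↭-length (shift x ys₁ ys₂)) len≤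
    ... | s≤s len≤ = len≤

distinctᵇ⇒Unique : ∀ {d} (L : List (Fin d)) → T (distinctᵇ L) → Unique L
distinctᵇ⇒Unique []      _ = []
distinctᵇ⇒Unique (x ∷ L) distinct with Equivalence.to T-∧ distinct
... | x-fresh , distinct-L = ¬Any⇒All¬ L x∉L ∷ distinctᵇ⇒Unique L distinct-L
  where
  T-not⇒¬T : ∀ {b} → T (not b) → ¬ T b
  T-not⇒¬T {false} _  ()
  T-not⇒¬T {true}  () _
  x∉L : x ∉ L
  x∉L x∈L = T-not⇒¬T x-fresh (any⁺ _ (Any.map (λ { ≡.refl → ≡⇒≡ᵇ (toℕ x) (toℕ x) ≡.refl }) x∈L))

toList↭allFin : ∀ {d} (σ : Vec (Fin d) d) → T (distinctᵇ (toList σ)) → toList σ ↭ allFin d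
toList↭allFin {d} σ distinct =
  unique∧⊆∧length≤⇒↭ (distinctᵇ⇒Unique (toList σ) distinct) (λ {i} _ → ∈-allFin i)
    (≤-reflexive (≡.trans (length-tabulate (λ i → i)) (≡.sym (length-toList σ))))

∈perms⇒distinct : ∀ {d σ} → σ ∈ perms d → T (distinctᵇ (toList σ))
∈perms⇒distinct {d} σ∈ =
  proj₂ (∈-filter⁻ {P = λ σ → T (distinctᵇ (toList σ))} (T? ∘ (distinctᵇ ∘ toList)) {xs = allVecs d d} σ∈)

data AscendingFrom (b : ℕ) : List ℕ → Set where
  []  : AscendingFrom b []
  _∷_ : ∀ {x w} → b ≤ x → AscendingFrom (suc x) w → AscendingFrom b (x ∷ w)

ascendingFrom-≤ : ∀ {b b′ w} → b′ ≤ b → AscendingFrom b w → AscendingFrom b′ w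
ascendingFrom-≤ b′≤b []          = []
ascendingFrom-≤ b′≤b (b≤x ∷ asc) = ≤-trans b′≤b b≤x ∷ asc

normW-ascending : ∀ {b w} → AscendingFrom b w → normW w ≡ just (false , w)
normW-ascending []                           = ≡.refl
normW-ascending (_ ∷ [])                     = ≡.refl
normW-ascending {w = x ∷ y ∷ w} (_ ∷ asc@(x<y ∷ _)) = begin
  normW (x ∷ y ∷ w)                  ≡⟨ normW-∷ x (y ∷ w) ⟩
  insertNF x (normW (y ∷ w))         ≡⟨ ≡.cong (insertNF x) (normW-ascending asc) ⟩
  flipNF false (insertS x (y ∷ w))   ≡⟨ ≡.cong (flipNF false) (insertS-< w x<y) ⟩
  just (false , x ∷ y ∷ w)           ∎
  where open ≡.≡-Reasoning

3+3k≤3[1+k] : ∀ k → 3 ℕ.+ 3 ℕ.* k ≤ 3 ℕ.* suc k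
3+3k≤3[1+k] k = ≤-reflexive (≡.sym (*-suc 3 k))

module _ {d} (I : Subset d) where

  ascending-genWord : ∀ j {k w} → toℕ j ≡ k → AscendingFrom (3 ℕ.* suc k) w →
                      AscendingFrom (3 ℕ.* k) (genWord I j ++ w)
  ascending-genWord j {k} ≡.refl asc with lookup I j
  ... | true  = ≤-refl ∷ ascendingFrom-≤ (≤-trans (m≤n+m _ 2) (3+3k≤3[1+k] k)) asc
  ... | false = n≤1+n _ ∷ ≤-refl ∷ ascendingFrom-≤ (3+3k≤3[1+k] k) asc

  ascending-genWords : ∀ {n} (f : Fin n → Fin d) k → (∀ i → toℕ (f i) ≡ k ℕ.+ toℕ i) →
                       AscendingFrom (3 ℕ.* k) (concatMap (genWord I) (tabulate f))
  ascending-genWords {zero}  f k f-consecutive = []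
  ascending-genWords {suc n} f k f-consecutive =
    ascending-genWord (f Fin.zero) (≡.trans (f-consecutive Fin.zero) (ℕₚ.+-identityʳ k))
      (ascending-genWords (f ∘ Fin.suc) (suc k) (λ i → ≡.trans (f-consecutive (Fin.suc i)) (+-suc k (toℕ i))))

  ascending-genWords-allFin : AscendingFrom 0 (concatMap (genWord I) (allFin d))
  ascending-genWords-allFin = ascending-genWords (λ i → i) 0 (λ _ → ≡.refl)

  oddLength-genWord : ∀ j → oddLength (genWord I j) ≡ lookup I j
  oddLength-genWord j with lookup I j
  ... | true  = ≡.refl
  ... | false = ≡.refl

-- Linear functionals on E ⊗ E

module _ {c ℓ} (F : Field c ℓ) where
  open Field F
  open CommutativeSemigroupProperties +-commutativeSemigroup using () renaming (interchange to +-interchange)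
  open CommutativeSemigroupProperties *-commutativeSemigroup using (x∙yz≈y∙xz) renaming (interchange to *-interchange)
  open RingProperties ring using (-1*x≈-x; -‿involutive)
  open import Relation.Binary.Reasoning.Setoid setoid

  Functional : Set c
  Functional = List ℕ → List ℕ → Carrier

  extend : Functional → EE F → Carrier
  extend φ []                = 0#
  extend φ ((k , u , v) ∷ x) = k * φ u v + extend φ x

  monomial : List ℕ → List ℕ → EE F
  monomial u v = (1# , u , v) ∷ []

  prefixed : Functional → List ℕ → List ℕ → Functional
  prefixed φ u v u′ v′ = φ (u ++ u′) (v ++ v′)

  extend-cong : ∀ {φ ψ} → (∀ u v → φ u v ≈ ψ u v) → ∀ x → extend φ x ≈ extend ψ x
  extend-cong φ≈ψ []                = refl
  extend-cong φ≈ψ ((k , u , v) ∷ x) = +-cong (*-congˡ (φ≈ψ u v)) (extend-cong φ≈ψ x)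

  extend-zero : ∀ {φ} → (∀ u v → φ u v ≈ 0#) → ∀ x → extend φ x ≈ 0#
  extend-zero φ≈0 []                = refl
  extend-zero φ≈0 ((k , u , v) ∷ x) = begin
    k * _ + extend _ x  ≈⟨ +-cong (*-congˡ (φ≈0 u v)) (extend-zero φ≈0 x) ⟩
    k * 0# + 0#         ≈⟨ +-identityʳ _ ⟩
    k * 0#              ≈⟨ zeroʳ k ⟩
    0#                  ∎

  extend-+ : ∀ φ ψ x → extend (λ u v → φ u v + ψ u v) x ≈ extend φ x + extend ψ x
  extend-+ φ ψ []                = sym (+-identityʳ 0#)
  extend-+ φ ψ ((k , u , v) ∷ x) = begin
    k * (φ u v + ψ u v) + extend _ x                      ≈⟨ +-cong (distribˡ k _ _) (extend-+ φ ψ x) ⟩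
    (k * φ u v + k * ψ u v) + (extend φ x + extend ψ x)  ≈⟨ +-interchange _ _ _ _ ⟩
    (k * φ u v + extend φ x) + (k * ψ u v + extend ψ x)  ∎

  extend-*ˡ : ∀ k φ x → extend (λ u v → k * φ u v) x ≈ k * extend φ x
  extend-*ˡ k φ []                 = sym (zeroʳ k)
  extend-*ˡ k φ ((k′ , u , v) ∷ x) = begin
    k′ * (k * φ u v) + extend _ x       ≈⟨ +-cong (x∙yz≈y∙xz k′ k _) (extend-*ˡ k φ x) ⟩
    k * (k′ * φ u v) + k * extend φ x   ≈⟨ sym (distribˡ k _ _) ⟩
    k * (k′ * φ u v + extend φ x)       ∎

  extend-++ : ∀ φ x y → extend φ (x ++ y) ≈ extend φ x + extend φ y
  extend-++ φ []                y = sym (+-identityˡ _)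
  extend-++ φ ((k , u , v) ∷ x) y = trans (+-congˡ (extend-++ φ x y)) (sym (+-assoc _ _ _))

  extend-· : ∀ φ k x → extend φ (_·EE_ F k x) ≈ k * extend φ x
  extend-· φ k []                 = sym (zeroʳ k)
  extend-· φ k ((k′ , u , v) ∷ x) =
    trans (+-cong (*-assoc k k′ _) (extend-· φ k x)) (sym (distribˡ k _ _))

  extend-monomial : ∀ φ u v → extend φ (monomial u v) ≈ φ u v
  extend-monomial φ u v = trans (+-identityʳ _) (*-identityˡ _)

  extend-*EE : ∀ φ x y → extend φ (_*EE_ F x y) ≈ extend (λ u v → extend (prefixed φ u v) y) x
  extend-*EE φ []                y = refl
  extend-*EE φ ((k , u , v) ∷ x) y = begin
    extend φ (map _ y ++ _*EE_ F x y)            ≈⟨ extend-++ φ (map _ y) _ ⟩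
    extend φ (map _ y) + extend φ (_*EE_ F x y)  ≈⟨ +-cong (scaled y) (extend-*EE φ x y) ⟩
    k * extend (prefixed φ u v) y + extend _ x   ∎
    where
    scaled : ∀ y → extend φ (map (λ { (k′ , u′ , v′) → (k * k′ , u ++ u′ , v ++ v′) }) y) ≈ k * extend (prefixed φ u v) y
    scaled []                   = sym (zeroʳ k)
    scaled ((k′ , u′ , v′) ∷ y) = trans (+-cong (*-assoc k k′ _) (scaled y)) (sym (distribˡ k _ _))

  extend-monomial-*EE : ∀ φ u v y → extend φ (_*EE_ F (monomial u v) y) ≈ extend (prefixed φ u v) y
  extend-monomial-*EE φ u v y =
    trans (extend-*EE φ (monomial u v) y) (extend-monomial (λ u′ v′ → extend (prefixed φ u′ v′) y) u v)

  extend-comm : ∀ (φ : List ℕ → List ℕ → Functional) x y →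
    extend (λ u v → extend (φ u v) y) x ≈ extend (λ u′ v′ → extend (λ u v → φ u v u′ v′) x) y
  extend-comm φ []                y = sym (extend-zero (λ _ _ → refl) y)
  extend-comm φ ((k , u , v) ∷ x) y = begin
    k * extend (φ u v) y + extend _ x                  ≈⟨ +-cong (sym (extend-*ˡ k (φ u v) y)) (extend-comm φ x y) ⟩
    extend (λ u′ v′ → k * φ u v u′ v′) y + extend _ y  ≈⟨ sym (extend-+ _ _ y) ⟩
    extend (λ u′ v′ → k * φ u v u′ v′ + extend (λ u v → φ u v u′ v′) x) y ∎

  ∑ : ∀ {a} {A : Set a} → List A → (A → Carrier) → Carrier
  ∑ xs g = foldr _+_ 0# (map g xs)

  module _ {a} {A : Set a} where

    ∑-cong : ∀ (xs : List A) {g h} → (∀ {σ} → σ ∈ xs → g σ ≈ h σ) → ∑ xs g ≈ ∑ xs h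
    ∑-cong []       g≈h = refl
    ∑-cong (σ ∷ xs) g≈h = +-cong (g≈h (here ≡.refl)) (∑-cong xs (g≈h ∘ there))

    ∑-*ʳ : ∀ (xs : List A) g k → ∑ xs (λ σ → g σ * k) ≈ ∑ xs g * k
    ∑-*ʳ []       g k = sym (zeroˡ k)
    ∑-*ʳ (σ ∷ xs) g k = trans (+-congˡ (∑-*ʳ xs g k)) (sym (distribʳ k _ _))

    extend-∑ : ∀ (xs : List A) (ψ : A → Functional) x →
               ∑ xs (λ σ → extend (ψ σ) x) ≈ extend (λ u v → ∑ xs (λ σ → ψ σ u v)) x
    extend-∑ []       ψ x = sym (extend-zero (λ _ _ → refl) x)
    extend-∑ (σ ∷ xs) ψ x = trans (+-congˡ (extend-∑ xs ψ x)) (sym (extend-+ (ψ σ) _ x))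

    extend-concat : ∀ φ (xs : List A) (h : A → EE F) →
                    extend φ (foldr (_+EE_ F) (zeroEE F) (map h xs)) ≈ ∑ xs (λ σ → extend φ (h σ))
    extend-concat φ []       h = refl
    extend-concat φ (σ ∷ xs) h = trans (extend-++ φ (h σ) _) (+-congˡ (extend-concat φ xs h))

  coeffPair : List ℕ → List ℕ → Functional
  coeffPair s₁ s₂ u v = coeffW F u s₁ * coeffW F v s₂

  coeffEE≡extend : ∀ x s₁ s₂ → coeffEE F x s₁ s₂ ≡ extend (coeffPair s₁ s₂) x
  coeffEE≡extend []                s₁ s₂ = ≡.refl
  coeffEE≡extend ((k , u , v) ∷ x) s₁ s₂ = ≡.cong (k * coeffPair s₁ s₂ u v +_) (coeffEE≡extend x s₁ s₂)

  sgn-xor : ∀ a b → sgn F (a xor b) ≈ sgn F a * sgn F b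
  sgn-xor false b     = sym (*-identityˡ _)
  sgn-xor true  false = sym (*-identityʳ _)
  sgn-xor true  true  = sym (trans (-1*x≈-x (- 1#)) (-‿involutive 1#))

  coeffNF : NF → List ℕ → Carrier
  coeffNF nothing        t = 0#
  coeffNF (just (b , v)) t = if eqL v t then sgn F b else 0#

  coeffW≡coeffNF : ∀ w t → coeffW F w t ≡ coeffNF (normW w) t
  coeffW≡coeffNF w t with normW w
  ... | nothing = ≡.refl
  ... | just _  = ≡.refl

  coeffNF-flipNF : ∀ s m t → coeffNF (flipNF s m) t ≈ sgn F s * coeffNF m t
  coeffNF-flipNF s nothing        t = sym (zeroʳ _)
  coeffNF-flipNF s (just (b , v)) t with eqL v t
  ... | true  = sgn-xor s b
  ... | false = sym (zeroʳ _)

  coeffW-≃ : ∀ {w w′ s} → w ≃[ s ] w′ → ∀ t → coeffW F w t ≈ sgn F s * coeffW F w′ t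
  coeffW-≃ {w} {w′} {s} (mk≃ w≃w′) t = begin
    coeffW F w t                    ≡⟨ coeffW≡coeffNF w t ⟩
    coeffNF (normW w) t             ≡⟨ ≡.cong (λ m → coeffNF m t) w≃w′ ⟩
    coeffNF (flipNF s (normW w′)) t ≈⟨ coeffNF-flipNF s (normW w′) t ⟩
    sgn F s * coeffNF (normW w′) t  ≡⟨ ≡.cong (sgn F s *_) (coeffW≡coeffNF w′ t) ⟨
    sgn F s * coeffW F w′ t         ∎

  coeffW-ascending-self : ∀ {b w} → AscendingFrom b w → coeffW F w w ≡ 1#
  coeffW-ascending-self {w = w} asc rewrite coeffW≡coeffNF w w | normW-ascending asc | eqL-refl w = ≡.refl

  fI-normW : ∀ {d} (I : Subset d) σ {b w} → normW (concatMap (genWord I) (toList σ)) ≡ just (b , w) → fI F I σ ≡ sgn F b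
  fI-normW I σ eq rewrite eq = ≡.refl

  module _ {d} (I : Subset d) (σ : Vec (Fin d) d) (σ↭id : toList σ ↭ allFin d) where

    fI-permSign : fI F I σ ≡ sgn F (permSign (lookup I) σ↭id)
    fI-permSign =
      ≡.trans (fI-normW I σ normW-σ) (≡.cong (sgn F) (≡.trans (xor-identityʳ _) (permSign-cong (oddLength-genWord I) σ↭id)))
      where
      normW-σ = ≡.trans (normW-≃ (concatMap-↭ (genWord I) σ↭id))
                        (≡.cong (flipNF _) (normW-ascending (ascending-genWords-allFin I)))

    coeffW-permute : ∀ (U : Fin d → List ℕ) → (∀ j → oddLength (U j) ≡ lookup I j) → ∀ t →
                     coeffW F (concatMap U (toList σ)) t ≈ fI F I σ * coeffW F (concatMap U (allFin d)) t
    coeffW-permute U U-parity t = begin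
      coeffW F (concatMap U (toList σ)) t                          ≈⟨ coeffW-≃ (concatMap-↭ U σ↭id) t ⟩
      sgn F (permSign (oddLength ∘ U) σ↭id) * coeffW F idWord t    ≡⟨ ≡.cong (λ s → sgn F s * _) (permSign-cong U-parity σ↭id) ⟩
      sgn F (permSign (lookup I) σ↭id) * coeffW F idWord t         ≡⟨ ≡.cong (_* _) fI-permSign ⟨
      fI F I σ * coeffW F idWord t                                 ∎
      where idWord = concatMap U (allFin d)

  -- Multilinearity of evaluation

  module _ {d : ℕ} where

    prodL : (Fin d → EE F) → List (Fin d) → EE F
    prodL a = foldr (λ i r → _*EE_ F (a i) r) (oneEE F)

    prodL-cong : ∀ {a b} L → (∀ {j} → j ∈ L → a j ≡ b j) → prodL a L ≡ prodL b L
    prodL-cong []      a≡b = ≡.refl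
    prodL-cong (j ∷ L) a≡b = ≡.cong₂ (_*EE_ F) (a≡b (here ≡.refl)) (prodL-cong L (a≡b ∘ there))

    infixl 6 _[_]≔_
    _[_]≔_ : (Fin d → EE F) → Fin d → EE F → (Fin d → EE F)
    a [ i ]≔ x = updateAt a i (const x)

    prodL-[]≔-head : ∀ a i y {L} → All (i ≢_) L → prodL (a [ i ]≔ y) (i ∷ L) ≡ _*EE_ F y (prodL a L)
    prodL-[]≔-head a i y {L} i∉L =
      ≡.cong₂ (_*EE_ F) (updateAt-updates i a) (prodL-cong L (λ j∈L → updateAt-minimal _ i a (≢-sym (All.lookup i∉L j∈L))))

    prodL-linear : ∀ a i x {L} → Unique L → i ∈ L → ∀ φ →
                   extend φ (prodL (a [ i ]≔ x) L) ≈ extend (λ u v → extend φ (prodL (a [ i ]≔ monomial u v) L)) x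
    prodL-linear a i x {.i ∷ L} (i∉L ∷ _) (here ≡.refl) φ = begin
      extend φ (prodL (a [ i ]≔ x) (i ∷ L))         ≡⟨ ≡.cong (extend φ) (prodL-[]≔-head a i x i∉L) ⟩
      extend φ (_*EE_ F x R)                        ≈⟨ extend-*EE φ x R ⟩
      extend (λ u v → extend (prefixed φ u v) R) x  ≈⟨ extend-cong (λ u v → sym (head-monomial u v)) x ⟩
      extend (λ u v → extend φ (prodL (a [ i ]≔ monomial u v) (i ∷ L))) x ∎
      where
      R = prodL a L
      head-monomial : ∀ u v → extend φ (prodL (a [ i ]≔ monomial u v) (i ∷ L)) ≈ extend (prefixed φ u v) R
      head-monomial u v =
        trans (reflexive (≡.cong (extend φ) (prodL-[]≔-head a i _ i∉L))) (extend-monomial-*EE φ u v R)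
    prodL-linear a i x {j ∷ L} (j∉L ∷ unique) (there i∈L) φ = begin
      extend φ (_*EE_ F ((a [ i ]≔ x) j) (P x))
        ≡⟨ ≡.cong (λ y → extend φ (_*EE_ F y (P x))) aj ⟩
      extend φ (_*EE_ F (a j) (P x))
        ≈⟨ extend-*EE φ (a j) (P x) ⟩
      extend (λ u′ v′ → extend (prefixed φ u′ v′) (P x)) (a j)
        ≈⟨ extend-cong (λ u′ v′ → prodL-linear a i x unique i∈L (prefixed φ u′ v′)) (a j) ⟩
      extend (λ u′ v′ → extend (λ u v → extend (prefixed φ u′ v′) (P (monomial u v))) x) (a j)
        ≈⟨ extend-comm _ (a j) x ⟩
      extend (λ u v → extend (λ u′ v′ → extend (prefixed φ u′ v′) (P (monomial u v))) (a j)) x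
        ≈⟨ extend-cong (λ u v → sym (extend-*EE φ (a j) _)) x ⟩
      extend (λ u v → extend φ (_*EE_ F (a j) (P (monomial u v)))) x
        ≈⟨ extend-cong (λ u v → reflexive (≡.cong (λ y → extend φ (_*EE_ F y (P (monomial u v)))) (≡.sym aj))) x ⟩
      extend (λ u v → extend φ (_*EE_ F ((a [ i ]≔ monomial u v) j) (P (monomial u v)))) x ∎
      where
      P : EE F → EE F
      P y = prodL (a [ i ]≔ y) L
      aj : ∀ {y} → (a [ i ]≔ y) j ≡ a j
      aj = updateAt-minimal j i a (All.lookup j∉L i∈L)

    prodL-monomials : ∀ (U V : Fin d → List ℕ) L φ →
                      extend φ (prodL (λ j → monomial (U j) (V j)) L) ≈ φ (concatMap U L) (concatMap V L)
    prodL-monomials U V []      φ = extend-monomial φ [] []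
    prodL-monomials U V (j ∷ L) φ =
      trans (extend-monomial-*EE φ (U j) (V j) (prodL (λ j → monomial (U j) (V j)) L))
            (prodL-monomials U V L (prefixed φ (U j) (V j)))

    module _ (α : Vec (Fin d) d → Carrier) where

      coeffEE-evalP : ∀ a s₁ s₂ → coeffEE F (evalP F d α a) s₁ s₂ ≈
                      ∑ (perms d) (λ σ → α σ * extend (coeffPair s₁ s₂) (prodL a (toList σ)))
      coeffEE-evalP a s₁ s₂ = begin
        coeffEE F (evalP F d α a) s₁ s₂                                    ≡⟨ coeffEE≡extend (evalP F d α a) s₁ s₂ ⟩
        extend (coeffPair s₁ s₂) (evalP F d α a)                          ≈⟨ extend-concat (coeffPair s₁ s₂) (perms d) (λ σ → _·EE_ F (α σ) (prodEE F a σ)) ⟩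
        ∑ (perms d) (λ σ → extend (coeffPair s₁ s₂) (_·EE_ F (α σ) (prodEE F a σ))) ≈⟨ ∑-cong (perms d) (λ {σ} _ → extend-· (coeffPair s₁ s₂) (α σ) (prodEE F a σ)) ⟩
        ∑ (perms d) (λ σ → α σ * extend (coeffPair s₁ s₂) (prodL a (toList σ))) ∎

      evalP-linear : ∀ a i x s₁ s₂ → coeffEE F (evalP F d α (a [ i ]≔ x)) s₁ s₂ ≈
                     extend (λ u v → coeffEE F (evalP F d α (a [ i ]≔ monomial u v)) s₁ s₂) x
      evalP-linear a i x s₁ s₂ = begin
        coeffEE F (evalP F d α (a [ i ]≔ x)) s₁ s₂
          ≈⟨ coeffEE-evalP (a [ i ]≔ x) s₁ s₂ ⟩
        ∑ (perms d) (λ σ → α σ * extend B (prodL (a [ i ]≔ x) (toList σ)))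
          ≈⟨ ∑-cong (perms d) (λ {σ} σ∈ → trans (*-congˡ (linear σ∈)) (sym (extend-*ˡ (α σ) _ x))) ⟩
        ∑ (perms d) (λ σ → extend (λ u v → α σ * extend B (prodL (a [ i ]≔ monomial u v) (toList σ))) x)
          ≈⟨ extend-∑ (perms d) _ x ⟩
        extend (λ u v → ∑ (perms d) (λ σ → α σ * extend B (prodL (a [ i ]≔ monomial u v) (toList σ)))) x
          ≈⟨ extend-cong (λ u v → sym (coeffEE-evalP (a [ i ]≔ monomial u v) s₁ s₂)) x ⟩
        extend (λ u v → coeffEE F (evalP F d α (a [ i ]≔ monomial u v)) s₁ s₂) x ∎
        where
        B = coeffPair s₁ s₂
        linear : ∀ {σ} → σ ∈ perms d → extend B (prodL (a [ i ]≔ x) (toList σ)) ≈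
                 extend (λ u v → extend B (prodL (a [ i ]≔ monomial u v) (toList σ))) x
        linear {σ} σ∈ = prodL-linear a i x (distinctᵇ⇒Unique (toList σ) distinct)
          (∈-resp-↭ (↭-sym (toList↭allFin σ distinct)) (∈-allFin i)) B
          where distinct = ∈perms⇒distinct σ∈

      evalP-cong : ∀ {a b} → (∀ j → a j ≡ b j) → evalP F d α a ≡ evalP F d α b
      evalP-cong a≗b = ≡.cong (foldr (_+EE_ F) (zeroEE F))
        (map-cong (λ σ → ≡.cong (_·EE_ F (α σ)) (prodL-cong (toList σ) (λ {j} _ → a≗b j))) (perms d))

      IsMonomial : EE F → Set c
      IsMonomial x = ∃₂ λ u v → x ≡ monomial u v

      PI-of-monomials : (∀ (U V : Fin d → List ℕ) → IsZeroEE F (evalP F d α (λ j → monomial (U j) (V j)))) → IsPIofEE F d α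
      PI-of-monomials monomials-vanish a = vanish (allFin d) a (λ j j∉ → contradiction (∈-allFin j) j∉)
        where
        vanish : ∀ J a → (∀ j → j ∉ J → IsMonomial (a j)) → IsZeroEE F (evalP F d α a)
        vanish [] a monomial-a = vanish-monomial a (λ j → monomial-a j λ ())
          where
          vanish-monomial : ∀ a → (∀ j → IsMonomial (a j)) → IsZeroEE F (evalP F d α a)
          vanish-monomial a m s₁ s₂ =
            trans (reflexive (≡.cong (λ x → coeffEE F x s₁ s₂) (evalP-cong (λ j → proj₂ (proj₂ (m j))))))
                  (monomials-vanish (λ j → proj₁ (m j)) (λ j → proj₁ (proj₂ (m j))) s₁ s₂)
        vanish (i ∷ J) a monomial-a s₁ s₂ = begin
          coeffEE F (evalP F d α a) s₁ s₂
            ≡⟨ ≡.cong (λ x → coeffEE F x s₁ s₂) (evalP-cong (λ j → ≡.sym (updateAt-id-local i a ≡.refl j))) ⟩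
          coeffEE F (evalP F d α (a [ i ]≔ a i)) s₁ s₂
            ≈⟨ evalP-linear a i (a i) s₁ s₂ ⟩
          extend (λ u v → coeffEE F (evalP F d α (a [ i ]≔ monomial u v)) s₁ s₂) (a i)
            ≈⟨ extend-zero (λ u v → vanish J (a [ i ]≔ monomial u v) (still-monomial u v) s₁ s₂) (a i) ⟩
          0# ∎
          where
          still-monomial : ∀ u v j → j ∉ J → IsMonomial ((a [ i ]≔ monomial u v) j)
          still-monomial u v j j∉J with j ≟ i
          ... | yes ≡.refl = u , v , updateAt-updates i a
          ... | no j≢i     = ≡.subst IsMonomial (≡.sym (updateAt-minimal j i a j≢i))
                               (monomial-a j λ { (here j≡i) → j≢i j≡i ; (there j∈J) → j∉J j∈J })

      signedSum : Subset d → Subset d → Carrier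
      signedSum I₁ I₂ = sumPerms F d (λ σ → α σ * fI F I₁ σ * fI F I₂ σ)

      evalP-monomials : ∀ (U V : Fin d → List ℕ) {I₁ I₂} →
        (∀ j → oddLength (U j) ≡ lookup I₁ j) → (∀ j → oddLength (V j) ≡ lookup I₂ j) → ∀ s₁ s₂ →
        coeffEE F (evalP F d α (λ j → monomial (U j) (V j))) s₁ s₂ ≈
        signedSum I₁ I₂ * (coeffW F (concatMap U (allFin d)) s₁ * coeffW F (concatMap V (allFin d)) s₂)
      evalP-monomials U V {I₁} {I₂} U-parity V-parity s₁ s₂ = begin
        coeffEE F (evalP F d α (λ j → monomial (U j) (V j))) s₁ s₂
          ≈⟨ coeffEE-evalP (λ j → monomial (U j) (V j)) s₁ s₂ ⟩
        ∑ (perms d) (λ σ → α σ * extend (coeffPair s₁ s₂) (prodL (λ j → monomial (U j) (V j)) (toList σ)))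
          ≈⟨ ∑-cong (perms d) (λ {σ} σ∈ → *-congˡ (trans (prodL-monomials U V (toList σ) (coeffPair s₁ s₂)) (permute σ (∈perms⇒distinct σ∈)))) ⟩
        ∑ (perms d) (λ σ → α σ * ((fI F I₁ σ * A) * (fI F I₂ σ * B)))
          ≈⟨ ∑-cong (perms d) (λ _ → rearrange _ _ _ A B) ⟩
        ∑ (perms d) (λ σ → (α σ * fI F I₁ σ * fI F I₂ σ) * (A * B))
          ≈⟨ ∑-*ʳ (perms d) _ (A * B) ⟩
        signedSum I₁ I₂ * (A * B) ∎
        where
        A = coeffW F (concatMap U (allFin d)) s₁
        B = coeffW F (concatMap V (allFin d)) s₂
        permute : ∀ σ → T (distinctᵇ (toList σ)) →
                  coeffPair s₁ s₂ (concatMap U (toList σ)) (concatMap V (toList σ)) ≈ (fI F I₁ σ * A) * (fI F I₂ σ * B)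
        permute σ distinct = *-cong (coeffW-permute I₁ σ σ↭id U U-parity s₁) (coeffW-permute I₂ σ σ↭id V V-parity s₂)
          where σ↭id = toList↭allFin σ distinct
        rearrange : ∀ a f₁ f₂ x y → a * ((f₁ * x) * (f₂ * y)) ≈ (a * f₁ * f₂) * (x * y)
        rearrange a f₁ f₂ x y = begin
          a * ((f₁ * x) * (f₂ * y))  ≈⟨ *-congˡ (*-interchange f₁ x f₂ y) ⟩
          a * ((f₁ * f₂) * (x * y))  ≈⟨ *-assoc a _ _ ⟨
          (a * (f₁ * f₂)) * (x * y)  ≈⟨ *-congʳ (*-assoc a f₁ f₂) ⟨
          (a * f₁ * f₂) * (x * y)    ∎

      PI⇒signedSum≈0 : IsPIofEE F d α → ∀ I₁ I₂ → signedSum I₁ I₂ ≈ 0#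
      PI⇒signedSum≈0 PI I₁ I₂ = begin
        signedSum I₁ I₂                                              ≈⟨ *-identityʳ _ ⟨
        signedSum I₁ I₂ * 1#                                         ≈⟨ *-congˡ (*-identityʳ 1#) ⟨
        signedSum I₁ I₂ * (1# * 1#)                                  ≡⟨ ≡.cong₂ (λ x y → signedSum I₁ I₂ * (x * y))
                                                                          (coeffW-ascending-self (ascending-genWords-allFin I₁))
                                                                          (coeffW-ascending-self (ascending-genWords-allFin I₂)) ⟨
        signedSum I₁ I₂ * (coeffW F w₁ w₁ * coeffW F w₂ w₂)         ≈⟨ evalP-monomials (genWord I₁) (genWord I₂) {I₁} {I₂}
                                                                          (oddLength-genWord I₁) (oddLength-genWord I₂) w₁ w₂ ⟨
        coeffEE F (evalP F d α (λ j → monomial (genWord I₁ j) (genWord I₂ j))) w₁ w₂ ≈⟨ PI (λ j → monomial (genWord I₁ j) (genWord I₂ j)) w₁ w₂ ⟩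
        0#                                                           ∎
        where
        w₁ = concatMap (genWord I₁) (allFin d)
        w₂ = concatMap (genWord I₂) (allFin d)

      signedSum≈0⇒PI : (∀ I₁ I₂ → signedSum I₁ I₂ ≈ 0#) → IsPIofEE F d α
      signedSum≈0⇒PI signedSum≈0 = PI-of-monomials monomials-vanish
        where
        parities : ∀ (W : Fin d → List ℕ) j → oddLength (W j) ≡ lookup (Vec.tabulate (oddLength ∘ W)) j
        parities W j = ≡.sym (lookup∘tabulate (oddLength ∘ W) j)

        monomials-vanish : ∀ (U V : Fin d → List ℕ) → IsZeroEE F (evalP F d α (λ j → monomial (U j) (V j)))
        monomials-vanish U V s₁ s₂ = begin
          coeffEE F (evalP F d α (λ j → monomial (U j) (V j))) s₁ s₂
            ≈⟨ evalP-monomials U V {Vec.tabulate (oddLength ∘ U)} {Vec.tabulate (oddLength ∘ V)} (parities U) (parities V) s₁ s₂ ⟩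
          signedSum (Vec.tabulate (oddLength ∘ U)) (Vec.tabulate (oddLength ∘ V)) * A
            ≈⟨ *-congʳ (signedSum≈0 (Vec.tabulate (oddLength ∘ U)) (Vec.tabulate (oddLength ∘ V))) ⟩
          0# * A
            ≈⟨ zeroˡ A ⟩
          0# ∎
          where A = coeffW F (concatMap U (allFin d)) s₁ * coeffW F (concatMap V (allFin d)) s₂
lemma8p2 : ∀ {c ℓ} (F : Field c ℓ) → CharZero F →
    (d : ℕ) (α : Vec (Fin d) d → Field.Carrier F) →
    (IsPIofEE F d α →
       ∀ (I₁ I₂ : Subset d) →
         Field._≈_ F (sumPerms F d (λ σ → Field._*_ F (Field._*_ F (α σ) (fI F I₁ σ)) (fI F I₂ σ))) (Field.0# F))
    × ((∀ (I₁ I₂ : Subset d) →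
         Field._≈_ F (sumPerms F d (λ σ → Field._*_ F (Field._*_ F (α σ) (fI F I₁ σ)) (fI F I₂ σ))) (Field.0# F))
       → IsPIofEE F d α)
-- Characteristic 0 is not needed.
lemma8p2 F _ d α = PI⇒signedSum≈0 F α , signedSum≈0⇒PI F α
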